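{- Let $\varphi$ be an IPDL-formula all of whose propositional variables are among $p_1,\ldots,p_n$ and all of whose atomic program terms are among $a_1,\ldots,a_l$ ($l\geq1$). Let $\gamma=a_1\cup\cdots\cup a_l$, let $\cdot'$ be the translation given by $a_j'=a_j$, $(\alpha;\beta)'=\alpha';\beta'$, $(\alpha\cup\beta)'=\alpha'\cup\beta'$, $(\alpha\cap\beta)'=\alpha'\cap\beta'$, $(\alpha^*)'=(\alpha')^*$, $(\phi?)'=(\phi')?$, $p_i'=p_i$, $\bot'=\bot$, $(\phi\to\psi)'=\phi'\to\psi'$, $([\alpha]\phi)'=[\alpha'](p_{n+1}\to\phi')$, let $\Theta=p_{n+1}\wedge[\gamma^*](\langle\gamma\rangle p_{n+1}\to p_{n+1})$ and $\widehat{\varphi}=\Theta\wedge\varphi'$. Let $b$ be the lexicographically first atomic program term occurring in $\varphi$ if $\varphi$ contains one, and $b=a_1$ otherwise. With $\langle b\rangle^0\psi=\psi$, $\langle b\rangle^{j+1}\psi=\langle b\rangle\langle b\rangle^j\psi$, define for $m\in\{1,\ldots,n+1\}$ $$A_m=\langle b\rangle^m[b]\bot\wedge\neg\langle b\rangle^{m+1}[b]\bot\wedge\langle b\rangle(\langle b\rangle\top\wedge[b]\langle b\rangle\top),\qquad B_m=\langle b\rangle A_m,$$ and let $\varphi^*$ be the variable-free formula obtained from $\widehat{\varphi}$ by substituting $B_i$ for every occurrence of $p_i$, $1\leq i\leq n+1$. Then $\varphi$ is satisfiable if and only if $\varphi^*$ is satisfiable.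
   Context: IPDL (PDL with intersection): formulas and program terms are defined simultaneously by $\varphi ::= p \mid \bot \mid (\varphi\to\varphi)\mid [\alpha]\varphi$ and $\alpha ::= a \mid \varphi? \mid (\alpha;\alpha)\mid(\alpha\cup\alpha)\mid(\alpha\cap\alpha)\mid\alpha^*$, where $p$ ranges over propositional variables $p_1,p_2,\ldots$ and $a$ over atomic program terms $a_1,a_2,\ldots$. Abbreviations: $\neg\varphi=\varphi\to\bot$, $\top=\neg\bot$, $\wedge$ as usual, $\langle\alpha\rangle\varphi=\neg[\alpha]\neg\varphi$. A Kripke model is $\mathfrak{M}=(S,\{R_a\}_a,V)$ with $S$ nonempty, $R_a\subseteq S\times S$, $V$ mapping variables to subsets of $S$. $R_{\varphi?}=\{(s,s):\mathfrak{M},s\models\varphi\}$; $R_{\alpha;\beta}$ is relational composition; $R_{\alpha\cup\beta}=R_\alpha\cup R_\beta$; $R_{\alpha\cap\beta}=R_\alpha\cap R_\beta$; $R_{\alpha^*}$ is the reflexive transitive closure of $R_\alpha$; $\mathfrak{M},s\models p$ iff $s\in V(p)$; $\bot$ never true; $\to$ classical; $\mathfrak{M},s\models[\alpha]\varphi$ iff $\varphi$ holds at all $t$ with $(s,t)\in R_\alpha$. A formula is satisfiable if it is true at some state of some model. A formula is variable-free if it contains no propositional variables. -}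

module Defs where

open import Data.Nat using (ℕ; zero; suc; _≤_; _≤?_; _+_)
open import Data.List using (List; []; _∷_; _++_)
open import Data.Product using (Σ; _×_; _,_)
open import Data.Empty using (⊥)
open import Data.Sum using (_⊎_)
open import Data.Maybe using (Maybe; just; nothing)
open import Data.List.Relation.Unary.All using (All)
open import Relation.Nullary using (yes; no)
open import Relation.Binary.PropositionalEquality using (_≡_)
open import Relation.Binary.Construct.Closure.ReflexiveTransitive using (Star)

-- Syntax of IPDL.  Propositional variable p_i is  var i,
-- atomic program a_j is  atom j  (indices are the paper's indices).

mutual
  data Fm : Set where
    var  : ℕ → Fm
    bot  : Fm
    _⇒_  : Fm → Fm → Fm
    box  : Prog → Fm → Fm

  data Prog : Set where
    atom : ℕ → Prog
    _¿   : Fm → Prog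
    _⨾_  : Prog → Prog → Prog
    _∪ₚ_ : Prog → Prog → Prog
    _∩ₚ_ : Prog → Prog → Prog
    _⋆   : Prog → Prog

infixr 4 _⇒_

¬f : Fm → Fm
¬f φ = φ ⇒ bot

topf : Fm
topf = ¬f bot

_∧f_ : Fm → Fm → Fm
φ ∧f ψ = ¬f (φ ⇒ ¬f ψ)

dia : Prog → Fm → Fm
dia α φ = ¬f (box α (¬f φ))

record Model : Set₁ where
  field
    S : Set
    R : ℕ → S → S → Set
    V : ℕ → S → Set

module _ (M : Model) where
  open Model M

  mutual
    ⟦_⟧f : Fm → S → Set
    ⟦ var i ⟧f s   = V i s
    ⟦ bot ⟧f s     = ⊥
    ⟦ φ ⇒ ψ ⟧f s   = ⟦ φ ⟧f s → ⟦ ψ ⟧f s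
    ⟦ box α φ ⟧f s = (t : S) → ⟦ α ⟧p s t → ⟦ φ ⟧f t

    ⟦_⟧p : Prog → S → S → Set
    ⟦ atom j ⟧p s t  = R j s t
    ⟦ φ ¿ ⟧p s t     = (s ≡ t) × ⟦ φ ⟧f s
    ⟦ α ⨾ β ⟧p s t   = Σ S (λ u → ⟦ α ⟧p s u × ⟦ β ⟧p u t)
    ⟦ α ∪ₚ β ⟧p s t  = ⟦ α ⟧p s t ⊎ ⟦ β ⟧p s t
    ⟦ α ∩ₚ β ⟧p s t  = ⟦ α ⟧p s t × ⟦ β ⟧p s t
    ⟦ α ⋆ ⟧p s t     = Star ⟦ α ⟧p s t

Satisfiable : Fm → Set₁
Satisfiable φ = Σ Model (λ M → Σ (Model.S M) (λ s → ⟦_⟧f M φ s))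

mutual
  varsF : Fm → List ℕ
  varsF (var i)   = i ∷ []
  varsF bot       = []
  varsF (φ ⇒ ψ)   = varsF φ ++ varsF ψ
  varsF (box α φ) = varsP α ++ varsF φ

  varsP : Prog → List ℕ
  varsP (atom j)  = []
  varsP (φ ¿)     = varsF φ
  varsP (α ⨾ β)   = varsP α ++ varsP β
  varsP (α ∪ₚ β)  = varsP α ++ varsP β
  varsP (α ∩ₚ β)  = varsP α ++ varsP β
  varsP (α ⋆)     = varsP α

mutual
  atomsF : Fm → List ℕ
  atomsF (var i)   = []
  atomsF bot       = []
  atomsF (φ ⇒ ψ)   = atomsF φ ++ atomsF ψ
  atomsF (box α φ) = atomsP α ++ atomsF φ

  atomsP : Prog → List ℕ
  atomsP (atom j)  = j ∷ []
  atomsP (φ ¿)     = atomsF φ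
  atomsP (α ⨾ β)   = atomsP α ++ atomsP β
  atomsP (α ∪ₚ β)  = atomsP α ++ atomsP β
  atomsP (α ∩ₚ β)  = atomsP α ++ atomsP β
  atomsP (α ⋆)     = atomsP α

-- γ = a_1 ∪ ... ∪ a_l  (left-associated; l ≥ 1 is assumed, the l = 0
-- clause is never used)
gammaL : ℕ → Prog
gammaL zero          = atom 1
gammaL (suc zero)    = atom 1
gammaL (suc (suc k)) = gammaL (suc k) ∪ₚ atom (suc (suc k))

-- the translation ·'  (parameter n: p_{n+1} is var (suc n))
mutual
  trF : ℕ → Fm → Fm
  trF n (var i)   = var i
  trF n bot       = bot
  trF n (φ ⇒ ψ)   = trF n φ ⇒ trF n ψ
  trF n (box α φ) = box (trP n α) (var (suc n) ⇒ trF n φ)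

  trP : ℕ → Prog → Prog
  trP n (atom j)  = atom j
  trP n (φ ¿)     = trF n φ ¿
  trP n (α ⨾ β)   = trP n α ⨾ trP n β
  trP n (α ∪ₚ β)  = trP n α ∪ₚ trP n β
  trP n (α ∩ₚ β)  = trP n α ∩ₚ trP n β
  trP n (α ⋆)     = trP n α ⋆

Theta : ℕ → ℕ → Fm
Theta n l = var (suc n) ∧f box (gammaL l ⋆) (dia (gammaL l) (var (suc n)) ⇒ var (suc n))

hat : ℕ → ℕ → Fm → Fm
hat n l φ = Theta n l ∧f trF n φ

minList : List ℕ → Maybe ℕ
minList []       = nothing
minList (x ∷ xs) with minList xs
... | nothing = just x
... | just y with x ≤? y
...   | yes _ = just x
...   | no _  = just y

-- b: the first (least-indexed) atomic program occurring in φ, else a_1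
bIndex : Fm → ℕ
bIndex φ with minList (atomsF φ)
... | nothing = 1
... | just j  = j

diaPow : Prog → ℕ → Fm → Fm
diaPow β zero    ψ = ψ
diaPow β (suc j) ψ = dia β (diaPow β j ψ)

A : Prog → ℕ → Fm
A β m = diaPow β m (box β bot)
        ∧f (¬f (diaPow β (suc m) (box β bot))
        ∧f dia β (dia β topf ∧f box β (dia β topf)))

B : Prog → ℕ → Fm
B β m = dia β (A β m)

mutual
  substF : (ℕ → Fm) → Fm → Fm
  substF σ (var i)   = σ i
  substF σ bot       = bot
  substF σ (φ ⇒ ψ)   = substF σ φ ⇒ substF σ ψ
  substF σ (box α φ) = box (substP σ α) (substF σ φ)

  substP : (ℕ → Fm) → Prog → Prog
  substP σ (atom j)  = atom j
  substP σ (φ ¿)     = substF σ φ ¿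
  substP σ (α ⨾ β)   = substP σ α ⨾ substP σ β
  substP σ (α ∪ₚ β)  = substP σ α ∪ₚ substP σ β
  substP σ (α ∩ₚ β)  = substP σ α ∩ₚ substP σ β
  substP σ (α ⋆)     = substP σ α ⋆

σB : Prog → ℕ → ℕ → Fm
σB β n i with 1 ≤? i | i ≤? suc n
... | yes _ | yes _ = B β i
... | _     | _     = var i

starF : ℕ → ℕ → Fm → Fm
starF n l φ = substF (σB (atom (bIndex φ)) n) (hat n l φ)

module Submission where

-- φ* is  substF σ (Θ ∧ φ')  with σ : p_i ↦ B_i, and by the substitution lemma
-- a model of φ* is a model of Θ ∧ φ' in which p_i is read as B_i.  Both
-- directions then rest on the relativization lemma: if p_{n+1} propagates
-- backwards along the steps of a forward-closed region, φ' holds at a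
-- p_{n+1}-state of the region iff φ holds there in the restriction of the
-- model to the region's p_{n+1}-states.
--  * Soundness (reflect): Θ says precisely that p_{n+1} propagates backwards
--    along γ inside the γ*-region of the current state.
--  * Completeness (extend): a model M of φ is extended by gadget states,
--    attached by b-edges, such that B_i holds at an original state iff p_i
--    does (1 ≤ i ≤ n) and B_{n+1} holds exactly at the original states.  By
--    the generated-submodel lemma M is a copy of the restriction to B_{n+1},
--    and Θ holds because no edge leads from a gadget back into M.
-- Excluded middle is needed to take apart the classically defined ∧, and to
-- conclude p_i from B_i, which only excludes every way for p_i to fail.

open import Defs
open import Data.List using (_++_)
open import Data.Nat using (ℕ; zero; suc; _≤_; _≟_; _≤?_; z≤n; s≤s; s≤s⁻¹)
open import Data.Nat.Properties
  using (≤-refl; <⇒≤; <⇒≢; >⇒≢; suc-injective; m≤n⇒m<n∨m≡n; m≤n⇒m≤1+n)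
open import Data.Product using (∃; _×_; _,_; proj₁; proj₂)
open import Data.Product.Function.NonDependent.Propositional using (_×-⇔_)
open import Data.Sum using (_⊎_; inj₁; inj₂; [_,_])
open import Data.Sum.Function.Propositional using (_⊎-⇔_)
open import Data.Sum.Properties using (inj₁-injective)
open import Data.Empty using (⊥; ⊥-elim)
open import Data.Unit using (⊤; tt)
open import Data.List.Relation.Unary.All using (All; []; _∷_)
open import Data.List.Relation.Unary.All.Properties using (++⁻ˡ; ++⁻ʳ)
open import Function using (id; _∘_)
open import Function.Bundles using (_⇔_; mk⇔; Equivalence)
open import Function.Construct.Identity using (⇔-id)
open import Function.Related.TypeIsomorphisms using (→-cong-⇔)
open import Axiom.ExcludedMiddle using (ExcludedMiddle)
open import Axiom.DoubleNegationElimination using (em⇒dne)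
open import Level using (0ℓ)
open import Relation.Nullary using (¬_; yes; no)
open import Relation.Binary.PropositionalEquality using (_≡_; _≢_; refl; cong; cong₂; subst; sym)
open import Relation.Binary.Construct.Closure.ReflexiveTransitive
  using (Star; ε; _◅_; _◅◅_; return; map; fold; concat)

open Equivalence using (to; from)

infix 4 _∣_⊨_ _∣_─[_]→_

_∣_⊨_ : (M : Model) → Model.S M → Fm → Set
M ∣ s ⊨ φ = ⟦_⟧f M φ s

_∣_─[_]→_ : (M : Model) → Model.S M → Prog → Model.S M → Set
M ∣ s ─[ α ]→ t = ⟦_⟧p M α s t

-- Introducing a conjunction or a
-- diamond, or refuting a conjunct, is constructive; extracting the conjuncts
-- of a conjunction needs excluded middle, since  φ ∧f ψ  is  ¬(φ → ¬ψ).
module _ (M : Model) where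

  ∧-intro : ∀ φ ψ s → M ∣ s ⊨ φ → M ∣ s ⊨ ψ → M ∣ s ⊨ (φ ∧f ψ)
  ∧-intro φ ψ s a b k = k a b

  ∧-elim : ExcludedMiddle 0ℓ → ∀ φ ψ s → M ∣ s ⊨ (φ ∧f ψ) → M ∣ s ⊨ φ × M ∣ s ⊨ ψ
  ∧-elim em φ ψ s h =
    em⇒dne em (λ ¬a → h (λ a _ → ¬a a)) , em⇒dne em (λ ¬b → h (λ _ b → ¬b b))

  ∧-refuteˡ : ∀ φ ψ s → ¬ M ∣ s ⊨ φ → ¬ M ∣ s ⊨ (φ ∧f ψ)
  ∧-refuteˡ φ ψ s ¬a h = h (λ a _ → ¬a a)

  ∧-refuteʳ : ∀ φ ψ s → ¬ M ∣ s ⊨ ψ → ¬ M ∣ s ⊨ (φ ∧f ψ)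
  ∧-refuteʳ φ ψ s ¬b h = h (λ _ b → ¬b b)

  dia-intro : ∀ α ψ s t → M ∣ s ─[ α ]→ t → M ∣ t ⊨ ψ → M ∣ s ⊨ dia α ψ
  dia-intro α ψ s t r h k = k t r h

  dia-refute : ∀ α ψ s → (∀ t → M ∣ s ─[ α ]→ t → ¬ M ∣ t ⊨ ψ) → ¬ M ∣ s ⊨ dia α ψ
  dia-refute α ψ s f h = h f

infixl 9 _⟪_⟫

_⟪_⟫ : Model → (ℕ → Fm) → Model
M ⟪ σ ⟫ = record { S = Model.S M ; R = Model.R M ; V = λ i s → M ∣ s ⊨ σ i }

Star-⇔ : ∀ {S : Set} {T U : S → S → Set} → (∀ {x y} → T x y ⇔ U x y) →
         ∀ {x y} → Star T x y ⇔ Star U x y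
Star-⇔ e = mk⇔ (map (to e)) (map (from e))

module _ (M : Model) (σ : ℕ → Fm) where

  mutual
    substitution-F : ∀ φ {s} → (M ∣ s ⊨ substF σ φ) ⇔ (M ⟪ σ ⟫ ∣ s ⊨ φ)
    substitution-F (var i)   = ⇔-id _
    substitution-F bot       = ⇔-id ⊥
    substitution-F (φ ⇒ ψ)   = →-cong-⇔ (substitution-F φ) (substitution-F ψ)
    substitution-F (box α φ) = mk⇔
      (λ h t r → to (substitution-F φ) (h t (from (substitution-P α) r)))
      (λ h t r → from (substitution-F φ) (h t (to (substitution-P α) r)))

    substitution-P : ∀ α {s t} → (M ∣ s ─[ substP σ α ]→ t) ⇔ (M ⟪ σ ⟫ ∣ s ─[ α ]→ t)
    substitution-P (atom j) = ⇔-id _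
    substitution-P (φ ¿)    = ⇔-id _ ×-⇔ substitution-F φ
    substitution-P (α ⨾ β)  = mk⇔
      (λ (w , p , q) → w , to (substitution-P α) p , to (substitution-P β) q)
      (λ (w , p , q) → w , from (substitution-P α) p , from (substitution-P β) q)
    substitution-P (α ∪ₚ β) = substitution-P α ⊎-⇔ substitution-P β
    substitution-P (α ∩ₚ β) = substitution-P α ×-⇔ substitution-P β
    substitution-P (α ⋆)    = Star-⇔ (substitution-P α)

paths : ∀ (M : Model) {Ok : ℕ → Set} {G : Model.S M → Model.S M → Set} →
        (∀ {j t u} → Ok j → Model.R M j t u → G t u) →
        ∀ α → All Ok (atomsP α) → ∀ {t u} → M ∣ t ─[ α ]→ u → Star G t u
paths M step (atom j) (ok ∷ []) r       = return (step ok r)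
paths M step (φ ¿)    _         (refl , _) = ε
paths M step (α ⨾ β)  a (_ , p , q) =
  paths M step α (++⁻ˡ _ a) p ◅◅ paths M step β (++⁻ʳ _ a) q
paths M step (α ∪ₚ β) a (inj₁ p) = paths M step α (++⁻ˡ _ a) p
paths M step (α ∪ₚ β) a (inj₂ q) = paths M step β (++⁻ʳ _ a) q
paths M step (α ∩ₚ β) a (p , _)  = paths M step α (++⁻ˡ _ a) p
paths M step (α ⋆)    a ps       = concat (map (paths M step α a) ps)

mutual
  atomsF-trF : ∀ n φ → atomsF (trF n φ) ≡ atomsF φ
  atomsF-trF n (var i)   = refl
  atomsF-trF n bot       = refl
  atomsF-trF n (φ ⇒ ψ)   = cong₂ _++_ (atomsF-trF n φ) (atomsF-trF n ψ)
  atomsF-trF n (box α φ) = cong₂ _++_ (atomsP-trP n α) (atomsF-trF n φ)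

  atomsP-trP : ∀ n α → atomsP (trP n α) ≡ atomsP α
  atomsP-trP n (atom j)  = refl
  atomsP-trP n (φ ¿)     = atomsF-trF n φ
  atomsP-trP n (α ⨾ β)   = cong₂ _++_ (atomsP-trP n α) (atomsP-trP n β)
  atomsP-trP n (α ∪ₚ β)  = cong₂ _++_ (atomsP-trP n α) (atomsP-trP n β)
  atomsP-trP n (α ∩ₚ β)  = cong₂ _++_ (atomsP-trP n α) (atomsP-trP n β)
  atomsP-trP n (α ⋆)     = atomsP-trP n α

module _ (M : Model) where
  open Model M

  atom⇒γ : ∀ l {j t u} → 1 ≤ j → j ≤ l → R j t u → M ∣ t ─[ gammaL l ]→ u
  atom⇒γ (suc zero)    (s≤s z≤n) (s≤s z≤n) r = r
  atom⇒γ (suc (suc k)) {t = t} {u} 1≤j j≤l r =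
    [ (λ j<l → inj₁ (atom⇒γ (suc k) 1≤j (s≤s⁻¹ j<l) r))
    , (λ j≡l → inj₂ (subst (λ i → R i t u) j≡l r))
    ] (m≤n⇒m<n∨m≡n j≤l)

  γ⇒atom : ∀ l {t u} → M ∣ t ─[ gammaL l ]→ u → ∃ λ j → R j t u
  γ⇒atom zero          r        = 1 , r
  γ⇒atom (suc zero)    r        = 1 , r
  γ⇒atom (suc (suc k)) (inj₁ r) = γ⇒atom (suc k) r
  γ⇒atom (suc (suc k)) (inj₂ r) = _ , r

ThetaCondition : (M : Model) → ℕ → ℕ → Model.S M → Set
ThetaCondition M n l s =
  V (suc n) s ×
  (∀ {t u} → Star (M ∣_─[ gammaL l ]→_) s t → M ∣ t ─[ gammaL l ]→ u → V (suc n) u → V (suc n) t)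
  where open Model M

Θ-meaning : ExcludedMiddle 0ℓ → ∀ (M : Model) n l {s} →
            (M ∣ s ⊨ Theta n l) ⇔ ThetaCondition M n l s
Θ-meaning em M n l = mk⇔ elim intro
  where
  p = var (suc n)
  γ = gammaL l
  closure = box (γ ⋆) (dia γ p ⇒ p)

  elim : ∀ {s} → M ∣ s ⊨ Theta n l → ThetaCondition M n l s
  elim {s} h with ∧-elim M em p closure s h
  ... | ps , cl = ps , λ {t} {u} rt g pu → cl t rt (dia-intro M γ p t u g pu)

  intro : ∀ {s} → ThetaCondition M n l s → M ∣ s ⊨ Theta n l
  intro {s} (ps , back) = ∧-intro M p closure s ps
    λ t rt ⟨γ⟩p → em⇒dne em λ ¬pt → ⟨γ⟩p λ u g pu → ¬pt (back rt g pu)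

restrict : (N : Model) → (Model.S N → Set) → Model
restrict N D = record
  { S = Model.S N ; R = λ j t u → Model.R N j t u × D t × D u ; V = Model.V N }

restrict-stays : ∀ N D α {t u} → restrict N D ∣ t ─[ α ]→ u → D t → D u
restrict-stays N D (atom j) (_ , _ , du) _  = du
restrict-stays N D (φ ¿)    (refl , _)   dt = dt
restrict-stays N D (α ⨾ β)  (_ , p , q)  = restrict-stays N D β q ∘ restrict-stays N D α p
restrict-stays N D (α ∪ₚ β) (inj₁ p)     = restrict-stays N D α p
restrict-stays N D (α ∪ₚ β) (inj₂ q)     = restrict-stays N D β q
restrict-stays N D (α ∩ₚ β) (p , _)      = restrict-stays N D α p
restrict-stays N D (α ⋆)    ps           =
  fold (λ t u → D t → D u) (λ p k → k ∘ restrict-stays N D α p) id ps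

module Relativization
  (N : Model) (n : ℕ) (Ok : ℕ → Set)
  (G : Model.S N → Model.S N → Set) (Reach : Model.S N → Set)
  (atom⇒G   : ∀ {j t u} → Ok j → Model.R N j t u → G t u)
  (reach-G  : ∀ {t u} → Reach t → G t u → Reach u)
  (back-G   : ∀ {t u} → Reach t → G t u → Model.V N (suc n) u → Model.V N (suc n) t)
  where
  open Model N

  P : S → Set
  P = V (suc n)

  D : S → Set
  D t = Reach t × P t

  K : Model
  K = restrict N D

  reach-path : ∀ {t u} → Reach t → Star G t u → Reach u
  reach-path r ε        = r
  reach-path r (g ◅ gs) = reach-path (reach-G r g) gs

  back-path : ∀ {t u} → Reach t → Star G t u → P u → P t
  back-path r ε        pu = pu
  back-path r (g ◅ gs) pu = back-G r g (back-path (reach-G r g) gs pu)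

  enter : ∀ {t u} → D t → Star G t u → P u → D u
  enter (r , _) gs pu = reach-path r gs , pu

  between : ∀ {t w u} → D t → Star G t w → Star G w u → D u → D w
  between (r , _) g₁ g₂ (_ , pu) = reach-path r g₁ , back-path (reach-path r g₁) g₂ pu

  tr-path : ∀ α → All Ok (atomsP α) → ∀ {t u} → N ∣ t ─[ trP n α ]→ u → Star G t u
  tr-path α a = paths N atom⇒G (trP n α) (subst (All Ok) (sym (atomsP-trP n α)) a)

  mutual
    relativize-F : ∀ φ → All Ok (atomsF φ) → ∀ {t} → D t → (K ∣ t ⊨ φ) ⇔ (N ∣ t ⊨ trF n φ)
    relativize-F (var i)   _ _ = ⇔-id _
    relativize-F bot       _ _ = ⇔-id ⊥
    relativize-F (φ ⇒ ψ)   a d =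
      →-cong-⇔ (relativize-F φ (++⁻ˡ _ a) d) (relativize-F ψ (++⁻ʳ _ a) d)
    relativize-F (box α φ) a {t} d = mk⇔ into out-of
      where
      aα = ++⁻ˡ _ a
      aφ = ++⁻ʳ _ a

      into : K ∣ t ⊨ box α φ → N ∣ t ⊨ trF n (box α φ)
      into h u p pu = to (relativize-F φ aφ du) (h u (from (relativize-P α aα d du) p))
        where du = enter d (tr-path α aα p) pu

      out-of : N ∣ t ⊨ trF n (box α φ) → K ∣ t ⊨ box α φ
      out-of h u p = from (relativize-F φ aφ du) (h u (to (relativize-P α aα d du) p) (proj₂ du))
        where du = restrict-stays N D α p d

    relativize-P : ∀ α → All Ok (atomsP α) → ∀ {t u} → D t → D u →
                   (K ∣ t ─[ α ]→ u) ⇔ (N ∣ t ─[ trP n α ]→ u)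
    relativize-P (atom j) _ dt du = mk⇔ proj₁ (λ r → r , dt , du)
    relativize-P (φ ¿)    a dt du = ⇔-id _ ×-⇔ relativize-F φ a dt
    relativize-P (α ⨾ β)  a {t} {u} dt du = mk⇔ into out-of
      where
      aα = ++⁻ˡ _ a
      aβ = ++⁻ʳ _ a

      into : K ∣ t ─[ α ⨾ β ]→ u → N ∣ t ─[ trP n (α ⨾ β) ]→ u
      into (w , p , q) = w , to (relativize-P α aα dt dw) p , to (relativize-P β aβ dw du) q
        where dw = restrict-stays N D α p dt

      out-of : N ∣ t ─[ trP n (α ⨾ β) ]→ u → K ∣ t ─[ α ⨾ β ]→ u
      out-of (w , p , q) = w , from (relativize-P α aα dt dw) p , from (relativize-P β aβ dw du) q
        where dw = between dt (tr-path α aα p) (tr-path β aβ q) du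
    relativize-P (α ∪ₚ β) a dt du =
      relativize-P α (++⁻ˡ _ a) dt du ⊎-⇔ relativize-P β (++⁻ʳ _ a) dt du
    relativize-P (α ∩ₚ β) a dt du =
      relativize-P α (++⁻ˡ _ a) dt du ×-⇔ relativize-P β (++⁻ʳ _ a) dt du
    relativize-P (α ⋆)    a dt du = mk⇔ (relativize-⋆ α a dt) (relativize-⋆⁻ α a dt du)

    relativize-⋆ : ∀ α → All Ok (atomsP α) → ∀ {t u} → D t →
                   Star (K ∣_─[ α ]→_) t u → Star (N ∣_─[ trP n α ]→_) t u
    relativize-⋆ α a dt ε        = ε
    relativize-⋆ α a dt (p ◅ ps) = to (relativize-P α a dt dw) p ◅ relativize-⋆ α a dw ps
      where dw = restrict-stays N D α p dt

    relativize-⋆⁻ : ∀ α → All Ok (atomsP α) → ∀ {t u} → D t → D u →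
                    Star (N ∣_─[ trP n α ]→_) t u → Star (K ∣_─[ α ]→_) t u
    relativize-⋆⁻ α a dt du ε        = ε
    relativize-⋆⁻ α a dt du (p ◅ ps) =
      from (relativize-P α a dt dw) p ◅ relativize-⋆⁻ α a dw du ps
      where dw = between dt (tr-path α a p) (tr-path (α ⋆) a ps) du

reflect : ExcludedMiddle 0ℓ → ∀ n l φ β →
          All (λ j → 1 ≤ j × j ≤ l) (atomsF φ) →
          Satisfiable (substF (σB β n) (hat n l φ)) → Satisfiable φ
reflect em n l φ β aa (M , s , h) = K , s , from (relativize-F φ aa (ε , proj₁ θ)) (proj₂ θ∧φ′)
  where
  N : Model
  N = M ⟪ σB β n ⟫

  θ∧φ′ : N ∣ s ⊨ Theta n l × N ∣ s ⊨ trF n φ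
  θ∧φ′ = ∧-elim N em (Theta n l) (trF n φ) s (to (substitution-F M (σB β n) (hat n l φ)) h)

  θ : ThetaCondition N n l s
  θ = to (Θ-meaning em N n l) (proj₁ θ∧φ′)

  γ-step = N ∣_─[ gammaL l ]→_
  open Relativization N n (λ j → 1 ≤ j × j ≤ l) γ-step (Star γ-step s)
         (λ (1≤j , j≤l) r → atom⇒γ N l 1≤j j≤l r) (λ rt g → rt ◅◅ return g) (proj₂ θ)

σB-in-range : ∀ β n {i} → 1 ≤ i → i ≤ suc n → σB β n i ≡ B β i
σB-in-range β n {i} 1≤i i≤n+1 with 1 ≤? i | i ≤? suc n
... | yes _  | yes _   = refl
... | no 1≰i | _       = ⊥-elim (1≰i 1≤i)
... | yes _  | no i≰n+1 = ⊥-elim (i≰n+1 i≤n+1)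

module Embedding
  (M K : Model) (OkV : ℕ → Set) (e : Model.S M → Model.S K)
  (e-injective : ∀ {x y} → e x ≡ e y → x ≡ y)
  (e-R         : ∀ j {x y} → Model.R M j x y ⇔ Model.R K j (e x) (e y))
  (e-V         : ∀ {i} x → OkV i → Model.V M i x ⇔ Model.V K i (e x))
  (e-closed    : ∀ {j x u} → Model.R K j (e x) u → ∃ λ y → e y ≡ u)
  where

  image-closed : ∀ α {x u} → K ∣ e x ─[ α ]→ u → ∃ λ y → e y ≡ u
  image-closed (atom j) r          = e-closed r
  image-closed (φ ¿)    (refl , _) = _ , refl
  image-closed (α ⨾ β)  (_ , p , q) with image-closed α p
  ... | _ , refl = image-closed β q
  image-closed (α ∪ₚ β) (inj₁ p)   = image-closed α p
  image-closed (α ∪ₚ β) (inj₂ q)   = image-closed β q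
  image-closed (α ∩ₚ β) (p , _)    = image-closed α p
  image-closed (α ⋆)    ps         = closed-⋆ ps
    where
    closed-⋆ : ∀ {x u} → Star (K ∣_─[ α ]→_) (e x) u → ∃ λ y → e y ≡ u
    closed-⋆ ε = _ , refl
    closed-⋆ (p ◅ ps) with image-closed α p
    ... | _ , refl = closed-⋆ ps

  mutual
    embed-F : ∀ φ → All OkV (varsF φ) → ∀ x → (M ∣ x ⊨ φ) ⇔ (K ∣ e x ⊨ φ)
    embed-F (var i)   (ok ∷ []) x = e-V x ok
    embed-F bot       _ x = ⇔-id ⊥
    embed-F (φ ⇒ ψ)   a x = →-cong-⇔ (embed-F φ (++⁻ˡ _ a) x) (embed-F ψ (++⁻ʳ _ a) x)
    embed-F (box α φ) a x = mk⇔ into out-of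
      where
      aα = ++⁻ˡ _ a
      aφ = ++⁻ʳ _ a

      into : M ∣ x ⊨ box α φ → K ∣ e x ⊨ box α φ
      into h u p with image-closed α p
      ... | y , refl = to (embed-F φ aφ y) (h y (from (embed-P α aα x y) p))

      out-of : K ∣ e x ⊨ box α φ → M ∣ x ⊨ box α φ
      out-of h y p = from (embed-F φ aφ y) (h (e y) (to (embed-P α aα x y) p))

    embed-P : ∀ α → All OkV (varsP α) → ∀ x y → (M ∣ x ─[ α ]→ y) ⇔ (K ∣ e x ─[ α ]→ e y)
    embed-P (atom j) _ x y = e-R j
    embed-P (φ ¿)    a x y = mk⇔
      (λ { (refl , h) → refl , to (embed-F φ a x) h })
      (λ { (ex≡ey , h) → e-injective ex≡ey , from (embed-F φ a x) h })
    embed-P (α ⨾ β)  a x y = mk⇔ into out-of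
      where
      aα = ++⁻ˡ _ a
      aβ = ++⁻ʳ _ a

      into : M ∣ x ─[ α ⨾ β ]→ y → K ∣ e x ─[ α ⨾ β ]→ e y
      into (w , p , q) = e w , to (embed-P α aα x w) p , to (embed-P β aβ w y) q

      out-of : K ∣ e x ─[ α ⨾ β ]→ e y → M ∣ x ─[ α ⨾ β ]→ y
      out-of (w , p , q) with image-closed α p
      ... | z , refl = z , from (embed-P α aα x z) p , from (embed-P β aβ z y) q
    embed-P (α ∪ₚ β) a x y = embed-P α (++⁻ˡ _ a) x y ⊎-⇔ embed-P β (++⁻ʳ _ a) x y
    embed-P (α ∩ₚ β) a x y = embed-P α (++⁻ˡ _ a) x y ×-⇔ embed-P β (++⁻ʳ _ a) x y
    embed-P (α ⋆)    a x y = mk⇔ (embed-⋆ α a) (embed-⋆⁻ α a)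

    embed-⋆ : ∀ α → All OkV (varsP α) → ∀ {x y} →
              Star (M ∣_─[ α ]→_) x y → Star (K ∣_─[ α ]→_) (e x) (e y)
    embed-⋆ α a ε                  = ε
    embed-⋆ α a (_◅_ {j = w} p ps) = to (embed-P α a _ w) p ◅ embed-⋆ α a ps

    embed-⋆⁻ : ∀ α → All OkV (varsP α) → ∀ {x y} →
               Star (K ∣_─[ α ]→_) (e x) (e y) → Star (M ∣_─[ α ]→_) x y
    embed-⋆⁻ α a {x} {y} ps = walk ps refl
      where
      walk : ∀ {x′ v} → Star (K ∣_─[ α ]→_) (e x′) v → v ≡ e y → Star (M ∣_─[ α ]→_) x′ y
      walk ε        v≡ey = subst (Star _ _) (e-injective v≡ey) ε
      walk (p ◅ ps) v≡ey with image-closed α p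
      ... | z , refl = from (embed-P α a _ z) p ◅ walk ps v≡ey

deadEndIn : Prog → ℕ → Fm
deadEndIn β m = diaPow β m (box β bot)

liveTail : Prog → Fm
liveTail β = dia β (dia β topf ∧f box β (dia β topf))

module _ (M : Model) (β : Prog) where

  A-intro : ∀ m t → M ∣ t ⊨ deadEndIn β m → ¬ M ∣ t ⊨ deadEndIn β (suc m) →
            M ∣ t ⊨ liveTail β → M ∣ t ⊨ A β m
  A-intro m t d ¬d l =
    ∧-intro M (deadEndIn β m) (¬f (deadEndIn β (suc m)) ∧f liveTail β) t d
      (∧-intro M (¬f (deadEndIn β (suc m))) (liveTail β) t ¬d l)

  A-too-shallow : ∀ m t → ¬ M ∣ t ⊨ deadEndIn β m → ¬ M ∣ t ⊨ A β m
  A-too-shallow m = ∧-refuteˡ M (deadEndIn β m) (¬f (deadEndIn β (suc m)) ∧f liveTail β)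

  A-too-deep : ∀ m t → M ∣ t ⊨ deadEndIn β (suc m) → ¬ M ∣ t ⊨ A β m
  A-too-deep m t d = ∧-refuteʳ M (deadEndIn β m) (¬f (deadEndIn β (suc m)) ∧f liveTail β) t
    (∧-refuteˡ M (¬f (deadEndIn β (suc m))) (liveTail β) t (λ ¬d → ¬d d))

-- The model N extends M by gadget states,
-- connected by b-edges only:
--   chain k  — a b-path of length k down to the dead end chain 0 (k ≤ n);
--   loop     — a b-loop, where ⟨b⟩⊤ ∧ [b]⟨b⟩⊤ holds;
--   marker k — reaches chain k and loop, hence satisfies A_{k+1} and no
--              other A_m;
--   hub      — reaches every chain k (k ≤ n), so neither it nor any original
--              state satisfies an A_m with 1 ≤ m ≤ n.
-- Each original x gets b-edges to hub, to marker n, and to marker k whenever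
-- x ⊨ p_{k+1} (k+1 ≤ n).  So B_i holds at x iff x ⊨ p_i (1 ≤ i ≤ n), B_{n+1}
-- holds exactly at the original states, and no edge leaves the gadgets.
module Extension (n b : ℕ) (M : Model) where
  open Model M renaming (S to SM; R to RM; V to VM)

  data Gadget : Set where
    loop hub     : Gadget
    chain marker : ℕ → Gadget

  data _↝_ : Gadget → Gadget → Set where
    loop-loop    : loop ↝ loop
    chain-chain  : ∀ {k} → suc k ≤ n → chain (suc k) ↝ chain k
    hub-chain    : ∀ {k} → k ≤ n → hub ↝ chain k
    marker-chain : ∀ {k} → k ≤ n → marker k ↝ chain k
    marker-loop  : ∀ {k} → marker k ↝ loop

  data Attached (x : SM) : Gadget → Set where
    to-hub    : Attached x hub
    to-top    : Attached x (marker n)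
    to-marker : ∀ {k} → suc k ≤ n → VM (suc k) x → Attached x (marker k)

  S : Set
  S = SM ⊎ Gadget

  R : ℕ → S → S → Set
  R j (inj₁ x) (inj₁ y) = RM j x y
  R j (inj₁ x) (inj₂ g) = j ≡ b × Attached x g
  R j (inj₂ g) (inj₂ h) = j ≡ b × g ↝ h
  R j (inj₂ g) (inj₁ y) = ⊥

  -- The valuation of N is never consulted: only the variable-free B_i are
  -- evaluated in it.
  N : Model
  N = record { S = S ; R = R ; V = λ _ _ → ⊥ }

  β : Prog
  β = atom b

  Depth : ℕ → S → Set
  Depth m t = N ∣ t ⊨ deadEndIn β m

  chain-end : ∀ u → ¬ R b (inj₂ (chain 0)) u
  chain-end (inj₁ _) ()
  chain-end (inj₂ _) (_ , ())

  chain-depth : ∀ {k} → k ≤ n → Depth k (inj₂ (chain k))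
  chain-depth {zero}  _   = chain-end
  chain-depth {suc k} k<n = dia-intro N β (deadEndIn β k) (inj₂ (chain (suc k))) (inj₂ (chain k))
    (refl , chain-chain k<n) (chain-depth (<⇒≤ k<n))

  chain-depth-exact : ∀ m {k} → k ≤ n → m ≢ k → ¬ Depth m (inj₂ (chain k))
  chain-depth-exact zero    {zero}  _   m≢k _    = m≢k refl
  chain-depth-exact zero    {suc k} k<n _   dead = dead (inj₂ (chain k)) (refl , chain-chain k<n)
  chain-depth-exact (suc m) {zero}  _   _        =
    dia-refute N β (deadEndIn β m) (inj₂ (chain 0)) λ u r _ → chain-end u r
  chain-depth-exact (suc m) {suc k} k<n m≢k      =
    dia-refute N β (deadEndIn β m) (inj₂ (chain (suc k))) λ where
    (inj₁ _) ()
    (inj₂ _) (_ , chain-chain _) → chain-depth-exact m (<⇒≤ k<n) (m≢k ∘ cong suc)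

  loop-no-dead-end : ∀ m → ¬ Depth m (inj₂ loop)
  loop-no-dead-end zero    dead = dead (inj₂ loop) (refl , loop-loop)
  loop-no-dead-end (suc m) = dia-refute N β (deadEndIn β m) (inj₂ loop) λ where
    (inj₁ _) ()
    (inj₂ _) (_ , loop-loop) → loop-no-dead-end m

  loop-live : N ∣ inj₂ loop ⊨ dia β topf
  loop-live = dia-intro N β topf (inj₂ loop) (inj₂ loop) (refl , loop-loop) id

  loop-forever : N ∣ inj₂ loop ⊨ (dia β topf ∧f box β (dia β topf))
  loop-forever = ∧-intro N (dia β topf) (box β (dia β topf)) (inj₂ loop) loop-live λ where
    (inj₁ _) ()
    (inj₂ _) (_ , loop-loop) → loop-live

  marker-depth-exact : ∀ m {k} → m ≢ suc k → ¬ Depth m (inj₂ (marker k))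
  marker-depth-exact zero    _   dead = dead (inj₂ loop) (refl , marker-loop)
  marker-depth-exact (suc m) {k} m≢k = dia-refute N β (deadEndIn β m) (inj₂ (marker k)) λ where
    (inj₁ _) ()
    (inj₂ _) (_ , marker-chain k≤n) → chain-depth-exact m k≤n (m≢k ∘ cong suc)
    (inj₂ _) (_ , marker-loop)      → loop-no-dead-end m

  marker-A : ∀ {k} → k ≤ n → N ∣ inj₂ (marker k) ⊨ A β (suc k)
  marker-A {k} k≤n = A-intro N β (suc k) (inj₂ (marker k))
    (dia-intro N β (deadEndIn β k) (inj₂ (marker k)) (inj₂ (chain k))
      (refl , marker-chain k≤n) (chain-depth k≤n))
    (marker-depth-exact (suc (suc k)) (>⇒≢ ≤-refl))
    (dia-intro N β (dia β topf ∧f box β (dia β topf)) (inj₂ (marker k)) (inj₂ loop)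
      (refl , marker-loop) loop-forever)

  hub-depth : ∀ {k} → k ≤ n → Depth (suc k) (inj₂ hub)
  hub-depth {k} k≤n =
    dia-intro N β (deadEndIn β k) (inj₂ hub) (inj₂ (chain k))
      (refl , hub-chain k≤n) (chain-depth k≤n)

  original-depth : ∀ {k} x → k ≤ n → Depth (suc (suc k)) (inj₁ x)
  original-depth {k} x k≤n =
    dia-intro N β (deadEndIn β (suc k)) (inj₁ x) (inj₂ hub) (refl , to-hub) (hub-depth k≤n)

  gadget-edge-shallow : ∀ {g h} → g ↝ h → ¬ Depth (suc n) (inj₂ h)
  gadget-edge-shallow loop-loop          = loop-no-dead-end (suc n)
  gadget-edge-shallow (chain-chain k<n)  =
    chain-depth-exact (suc n) (<⇒≤ k<n) (>⇒≢ (s≤s (<⇒≤ k<n)))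
  gadget-edge-shallow (hub-chain k≤n)    = chain-depth-exact (suc n) k≤n (>⇒≢ (s≤s k≤n))
  gadget-edge-shallow (marker-chain k≤n) = chain-depth-exact (suc n) k≤n (>⇒≢ (s≤s k≤n))
  gadget-edge-shallow marker-loop        = loop-no-dead-end (suc n)

  top-original : ∀ x → N ∣ inj₁ x ⊨ B β (suc n)
  top-original x =
    dia-intro N β (A β (suc n)) (inj₁ x) (inj₂ (marker n)) (refl , to-top) (marker-A ≤-refl)

  top-gadget : ∀ g → ¬ N ∣ inj₂ g ⊨ B β (suc n)
  top-gadget g = dia-refute N β (A β (suc n)) (inj₂ g) λ where
    (inj₁ _) ()
    (inj₂ h) (_ , e) → A-too-shallow N β (suc n) (inj₂ h) (gadget-edge-shallow e)

  -- At an original state x and 1 ≤ i ≤ n, B_i holds iff x ⊨ p_i: marker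
  -- (i-1) is attached exactly when x ⊨ p_i, and every other b-successor of x
  -- is too deep (originals, hub) or of the wrong depth (markers) for A_i.
  var-original : ∀ {i} x → 1 ≤ i → i ≤ n → VM i x → N ∣ inj₁ x ⊨ B β i
  var-original {suc k} x (s≤s z≤n) i≤n v =
    dia-intro N β (A β (suc k)) (inj₁ x) (inj₂ (marker k))
      (refl , to-marker i≤n v) (marker-A (<⇒≤ i≤n))

  var-original⁻ : ExcludedMiddle 0ℓ → ∀ {i} x → 1 ≤ i → i ≤ n →
                  N ∣ inj₁ x ⊨ B β i → VM i x
  var-original⁻ em {suc k} x (s≤s z≤n) i≤n bx =
    em⇒dne em λ ¬v → dia-refute N β (A β (suc k)) (inj₁ x) (no-witness ¬v) bx
    where
    no-witness : ¬ VM (suc k) x → ∀ u → R b (inj₁ x) u → ¬ N ∣ u ⊨ A β (suc k)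
    no-witness _ (inj₁ y) _ = A-too-deep N β (suc k) (inj₁ y) (original-depth y (<⇒≤ i≤n))
    no-witness _ (inj₂ _) (_ , to-hub) = A-too-deep N β (suc k) (inj₂ hub) (hub-depth i≤n)
    no-witness _ (inj₂ _) (_ , to-top) =
      A-too-shallow N β (suc k) (inj₂ (marker n)) (marker-depth-exact (suc k) (<⇒≢ (s≤s i≤n)))
    no-witness ¬v (inj₂ _) (_ , to-marker {k′} _ v) with k ≟ k′
    ... | yes refl = ⊥-elim (¬v v)
    ... | no k≢k′  =
      A-too-shallow N β (suc k) (inj₂ (marker k′))
        (marker-depth-exact (suc k) (k≢k′ ∘ suc-injective))

  N^ : Model
  N^ = N ⟪ σB β n ⟫

  valuation : ∀ {i} t → 1 ≤ i → i ≤ suc n → Model.V N^ i t ⇔ (N ∣ t ⊨ B β i)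
  valuation t 1≤i i≤n+1 rewrite σB-in-range β n 1≤i i≤n+1 = ⇔-id _

  P : S → Set
  P = Model.V N^ (suc n)

  P-original : ∀ x → P (inj₁ x)
  P-original x = from (valuation (inj₁ x) (s≤s z≤n) ≤-refl) (top-original x)

  P-gadget : ∀ g → ¬ P (inj₂ g)
  P-gadget g = top-gadget g ∘ to (valuation (inj₂ g) (s≤s z≤n) ≤-refl)

  -- p_{n+1} propagates backwards along every edge: no edge leaves the gadgets
  P-back : ∀ {j t u} → R j t u → P u → P t
  P-back {t = inj₁ x}           _  _  = P-original x
  P-back {t = inj₂ _} {inj₂ h}  _  pu = ⊥-elim (P-gadget h pu)
  P-back {t = inj₂ _} {inj₁ _}  ()

  valuation-original : ExcludedMiddle 0ℓ → ∀ {i} x → 1 ≤ i × i ≤ n →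
                       VM i x ⇔ Model.V N^ i (inj₁ x)
  valuation-original em x (1≤i , i≤n) = mk⇔
    (from (valuation (inj₁ x) 1≤i (m≤n⇒m≤1+n i≤n)) ∘ var-original x 1≤i i≤n)
    (var-original⁻ em x 1≤i i≤n ∘ to (valuation (inj₁ x) 1≤i (m≤n⇒m≤1+n i≤n)))

  -- Relativize N^ with every state counted as reachable; the restriction K
  -- to p_{n+1} is a copy of M, embedded by inj₁.
  module _ (l : ℕ) where
    open Relativization N^ n (λ j → 1 ≤ j × j ≤ l) (λ t u → ∃ λ j → R j t u) (λ _ → ⊤)
           (λ _ r → _ , r) (λ _ _ → tt) (λ _ (_ , r) → P-back r)
      public using (K; relativize-F)

    inj₁-closed : ∀ {j x u} → Model.R K j (inj₁ x) u → ∃ λ y → inj₁ y ≡ u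
    inj₁-closed {u = inj₁ y} _                 = y , refl
    inj₁-closed {u = inj₂ g} (_ , _ , _ , pg) = ⊥-elim (P-gadget g pg)

    inj₁-edges : ∀ j {x y} → RM j x y ⇔ Model.R K j (inj₁ x) (inj₁ y)
    inj₁-edges j {x} {y} = mk⇔ (λ r → r , (tt , P-original x) , (tt , P-original y)) proj₁

  preserve : ExcludedMiddle 0ℓ → ∀ l φ →
             All (λ i → 1 ≤ i × i ≤ n) (varsF φ) → All (λ j → 1 ≤ j × j ≤ l) (atomsF φ) →
             ∀ x → M ∣ x ⊨ φ → N ∣ inj₁ x ⊨ substF (σB β n) (hat n l φ)
  preserve em l φ av aa x h =
    from (substitution-F N (σB β n) (hat n l φ)) (∧-intro N^ (Theta n l) (trF n φ) (inj₁ x) θ φ′)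
    where
    open Embedding M (K l) (λ i → 1 ≤ i × i ≤ n) inj₁ inj₁-injective (inj₁-edges l)
           (valuation-original em) (inj₁-closed l)
    θ = from (Θ-meaning em N^ n l) (P-original x , λ _ g pu → P-back (proj₂ (γ⇒atom N^ l g)) pu)
    φ′ = to (relativize-F l φ aa (tt , P-original x)) (to (embed-F φ av x) h)

extend : ExcludedMiddle 0ℓ → ∀ n l φ b →
         All (λ i → 1 ≤ i × i ≤ n) (varsF φ) → All (λ j → 1 ≤ j × j ≤ l) (atomsF φ) →
         Satisfiable φ → Satisfiable (substF (σB (atom b) n) (hat n l φ))
extend em n l φ b av aa (M , x , h) = N , inj₁ x , preserve em l φ av aa x h
  where open Extension n b M

lemma3 : ExcludedMiddle 0ℓ →
    (n l : ℕ) (φ : Fm) → 1 ≤ l →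
    All (λ i → 1 ≤ i × i ≤ n) (varsF φ) →
    All (λ j → 1 ≤ j × j ≤ l) (atomsF φ) →
    Satisfiable φ ⇔ Satisfiable (starF n l φ)
lemma3 em n l φ _ av aa =
  mk⇔ (extend em n l φ (bIndex φ) av aa) (reflect em n l φ (atom (bIndex φ)) aa)
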